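{- Let $V$ be the vertical half of the Riordan array $(1,f(x))$. Then $$V^{ -1}=\left(2-\frac{xf'(x)}{f(x)},\ \frac{x^2}{f(x)}\right).$$
   Context: All power series are formal power series with complex coefficients. A Riordan array is a pair $(g(x),f(x))$ of power series with $g(0)\neq 0$, $f(0)=0$, $f'(0)\neq 0$; it is identified with the infinite lower triangular matrix $(t_{n,k})_{n,k\ge 0}$, $t_{n,k}=[x^n]g(x)f(x)^k$. The product is $(g,f)\cdot(u,v)=(g(x)u(f(x)),v(f(x)))$, which corresponds to matrix multiplication, and Riordan arrays form a group under it. The vertical half of a Riordan array with matrix $(t_{n,k})$ is the matrix whose $(n,k)$ entry is $t_{2n-k,n}$ (with $t_{i,j}=0$ for $j>i$). -}

module Defs where

open import Level using (Level)
open import Data.Nat using (ℕ; zero; suc; _∸_; _≤ᵇ_; _≡ᵇ_)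
open import Data.Bool using (if_then_else_)
open import Algebra.Bundles using (CommutativeRing)

module FPS {c ℓ : Level} (R : CommutativeRing c ℓ) where
  open CommutativeRing R

  Series : Set c
  Series = ℕ → Carrier

  Matrix : Set c
  Matrix = ℕ → ℕ → Carrier

  sumTo : ℕ → (ℕ → Carrier) → Carrier
  sumTo zero    a = 0#
  sumTo (suc n) a = sumTo n a + a n

  natMul : ℕ → Carrier → Carrier
  natMul zero    a = 0#
  natMul (suc n) a = a + natMul n a

  _⋆_ : Series → Series → Series
  (a ⋆ b) n = sumTo (suc n) (λ i → a i * b (n ∸ i))

  pow : Series → ℕ → Series
  pow a zero    = λ n → if n ≡ᵇ 0 then 1# else 0#
  pow a (suc k) = a ⋆ pow a k

  X : Series
  X n = if n ≡ᵇ 1 then 1# else 0#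

  const : Carrier → Series
  const r n = if n ≡ᵇ 0 then r else 0#

  deriv : Series → Series
  deriv a n = natMul (suc n) (a (suc n))

  riordan : Series → Series → Matrix
  riordan g f n k = (g ⋆ pow f k) n

  -- vertical half of a matrix t: entry (n,k) is t (2n-k) n, where t i j = 0
  -- when j > i (i.e. when k > n; this also covers 2n-k < 0)
  vhalf : Matrix → Matrix
  vhalf t n k = if k ≤ᵇ n then t ((n Data.Nat.+ n) ∸ k) n else 0#

  -- product of infinite lower triangular matrices
  _⊗_ : Matrix → Matrix → Matrix
  (A ⊗ B) n k = sumTo (suc n) (λ j → A n j * B j k)

  identityM : Matrix
  identityM n k = if n ≡ᵇ k then 1# else 0#

  -- Multiplicative inverse of a series h with h 0 invertible (inverse u):
  -- b 0 = u,  b m = - u * Σ_{i=1}^{m} h i * b (m - i).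
  -- invStep n agrees with b on all indices ≤ n.
  invStep : Series → Carrier → ℕ → Series
  invStep h u zero    = λ _ → u
  invStep h u (suc n) = λ m →
    if m ≤ᵇ n then invStep h u n m
    else - (u * sumTo (suc n) (λ j → h (suc j) * invStep h u n (n ∸ j)))

  invSeries : Series → Carrier → Series
  invSeries h u n = invStep h u n n

  -- For f with f 0 = 0 and u * f 1 = 1, write f = x h with h n = f (n+1);
  -- then 1/h = invSeries h u, and
  --   x f'(x) / f(x) = f'(x) / h(x),     x^2 / f(x) = x / h(x).
  shiftDown : Series → Series
  shiftDown f n = f (suc n)

  gInv : Series → Carrier → Series
  gInv f u n = const (1# + 1#) n - (deriv f ⋆ invSeries (shiftDown f) u) n

  fInv : Series → Carrier → Series
  fInv f u = X ⋆ invSeries (shiftDown f) u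

module Submission where

-- Write f = x h and g = 1/h. The vertical half V of (1, f) has entries V(n, j) = [x^(n-j)] h^n, so
-- (V A)(n, k) = [x^n] (A(·, k) h^n) for every matrix A. For the Riordan array A = (G, x g) with
-- G = 2 - x f'/f = 1 - x h'/h the k-th column is x^k G g^k, and (V A)(k + m, k) collapses to
-- [x^m] G h^m = [x^m] h^m - [x^(m-1)] h' h^(m-1), which is 0 for m ≥ 1 because
-- [x^m] h^m = [x^(m-1)] h' h^(m-1). Over ℚ this follows from differentiating h^m, but in an
-- arbitrary commutative ring one cannot divide by m. Instead both coefficients are expanded over
-- tuples v ∈ ℕ^m with Σ v = m, weighted by h_{v_1} ⋯ h_{v_m}, the derivative side carrying the extra
-- multiplicity v_1. Tuples with the same sorted form have the same weight, and within such a class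
-- cyclic rotation shows that m times the v_1-weighted count equals m times the plain count; m
-- cancels in ℕ. Finally A V = I follows from V A = I since V is lower triangular with invertible
-- diagonal h_0^n.

open import Defs
open import Level using (Level)
open import Data.Nat using (ℕ)
open import Data.Product using (_×_)
open import Algebra.Bundles using (CommutativeRing)

open import Algebra.Bundles using (CommutativeSemiring; CommutativeMonoid)
open import Data.Bool using (Bool; true; false; _∧_; if_then_else_)
open import Data.List using (List; []; _∷_; _++_; [_]; length; foldr; map)
import Data.List.Properties as Listₚ
open import Data.List.Relation.Unary.All using (All; []; _∷_)
open import Data.List.Relation.Binary.Permutation.Propositional using (_↭_; ↭⇒↭ₛ′)
import Data.List.Relation.Binary.Permutation.Propositional as ↭
import Data.List.Relation.Binary.Permutation.Propositional.Properties as ↭ₚ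
open import Data.List.Relation.Binary.Pointwise using (Pointwise-≡⇒≡)
open import Data.Nat using (zero; suc; _∸_; _≤_; _<_; z≤n; s≤s; _≟_; _≡ᵇ_; _≤?_)
import Data.Nat as ℕ
import Data.Nat.Properties as ℕₚ
open import Data.Nat.ListAction using (sum)
open import Data.Nat.ListAction.Properties using (sum-↭)
open import Data.List.Sort.InsertionSort.Base ℕₚ.≤-decTotalOrder using (sort; insert)
open import Data.List.Sort.InsertionSort.Properties ℕₚ.≤-decTotalOrder using (sort-↭; insert-swap)
open import Data.Product using (_,_; ∃)
open import Data.Sum using (inj₁; inj₂)
open import Function using (_∘_)
open import Relation.Binary.PropositionalEquality using (_≡_; _≢_)
import Relation.Binary.PropositionalEquality as ≡
open import Relation.Nullary using (Dec; yes; no)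
open import Relation.Nullary.Decidable using (does; dec-true; dec-false)

⟦_⟧ : Bool → ℕ
⟦ true ⟧  = 1
⟦ false ⟧ = 0

_≟ₗ_ : (xs ys : List ℕ) → Dec (xs ≡ ys)
_≟ₗ_ = Listₚ.≡-dec _≟_

rotate : List ℕ → List ℕ
rotate []      = []
rotate (x ∷ l) = l ++ [ x ]

rotate-↭ : ∀ l → rotate l ↭ l
rotate-↭ []      = ↭.refl
rotate-↭ (x ∷ l) = ↭ₚ.++-comm l [ x ]

sort-cong-↭ : ∀ {l l′} → l ↭ l′ → sort l ≡ sort l′
sort-cong-↭ ↭.refl              = ≡.refl
sort-cong-↭ (↭.prep x p)        = ≡.cong (insert x) (sort-cong-↭ p)
sort-cong-↭ (↭.swap {xs} x y p) = ≡.trans (Pointwise-≡⇒≡ (insert-swap x y (sort xs)))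
                                          (≡.cong (insert y ∘ insert x) (sort-cong-↭ p))
sort-cong-↭ (↭.trans p q)       = ≡.trans (sort-cong-↭ p) (sort-cong-↭ q)

+-≡ᵇ-∸ : ∀ {i n} s → i ≤ n → (i ℕ.+ s ≡ᵇ n) ≡ (s ≡ᵇ n ∸ i)
+-≡ᵇ-∸ s z≤n       = ≡.refl
+-≡ᵇ-∸ s (s≤s i≤n) = +-≡ᵇ-∸ s i≤n

+-≡ᵇ-overshoot : ∀ {i n} s → n < i → (i ℕ.+ s ≡ᵇ n) ≡ false
+-≡ᵇ-overshoot {n = zero}  s (s≤s _)   = ≡.refl
+-≡ᵇ-overshoot {n = suc n} s (s≤s n<i) = +-≡ᵇ-overshoot s n<i

entry : List ℕ → ℕ → ℕ
entry []      _       = 0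
entry (x ∷ l) zero    = x
entry (x ∷ l) (suc j) = entry l j

entry-++ : ∀ l r j → j < length l → entry (l ++ r) j ≡ entry l j
entry-++ (x ∷ l) r zero    _       = ≡.refl
entry-++ (x ∷ l) r (suc j) j<∣l∣ = entry-++ l r j (ℕₚ.≤-pred j<∣l∣)

module Sums {c ℓ} (S : CommutativeSemiring c ℓ) where
  open CommutativeSemiring S
  open import Algebra.Definitions.RawMonoid +-rawMonoid public using () renaming (_×_ to _·_)
  open import Relation.Binary.Reasoning.Setoid setoid

  ∑< : ℕ → (ℕ → Carrier) → Carrier
  ∑< zero    a = 0#
  ∑< (suc n) a = ∑< n a + a n

  ∑<-cong : ∀ n {a b : ℕ → Carrier} → (∀ i → i < n → a i ≈ b i) → ∑< n a ≈ ∑< n b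
  ∑<-cong zero    a≈b = refl
  ∑<-cong (suc n) a≈b = +-cong (∑<-cong n λ i i<n → a≈b i (ℕₚ.m<n⇒m<1+n i<n)) (a≈b n ℕₚ.≤-refl)

  ∑<-zero : ∀ n {a : ℕ → Carrier} → (∀ i → i < n → a i ≈ 0#) → ∑< n a ≈ 0#
  ∑<-zero zero    a≈0 = refl
  ∑<-zero (suc n) a≈0 = trans (+-cong (∑<-zero n λ i i<n → a≈0 i (ℕₚ.m<n⇒m<1+n i<n)) (a≈0 n ℕₚ.≤-refl))
                              (+-identityˡ 0#)

  ∑<-distrib-+ : ∀ n (a b : ℕ → Carrier) → ∑< n (λ i → a i + b i) ≈ ∑< n a + ∑< n b
  ∑<-distrib-+ zero    a b = sym (+-identityˡ 0#)
  ∑<-distrib-+ (suc n) a b = begin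
    ∑< n (λ i → a i + b i) + (a n + b n) ≈⟨ +-congʳ (∑<-distrib-+ n a b) ⟩
    (∑< n a + ∑< n b) + (a n + b n)      ≈⟨ interchange _ _ _ _ ⟩
    (∑< n a + a n) + (∑< n b + b n)      ∎
    where open import Algebra.Properties.CommutativeSemigroup +-commutativeSemigroup using (interchange)

  *-distribˡ-∑< : ∀ n x (a : ℕ → Carrier) → x * ∑< n a ≈ ∑< n (λ i → x * a i)
  *-distribˡ-∑< zero    x a = zeroʳ x
  *-distribˡ-∑< (suc n) x a = trans (distribˡ x _ _) (+-congʳ (*-distribˡ-∑< n x a))

  *-distribʳ-∑< : ∀ n x (a : ℕ → Carrier) → ∑< n a * x ≈ ∑< n (λ i → a i * x)
  *-distribʳ-∑< zero    x a = zeroˡ x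
  *-distribʳ-∑< (suc n) x a = trans (distribʳ x _ _) (+-congʳ (*-distribʳ-∑< n x a))

  ∑<-+ : ∀ m n (a : ℕ → Carrier) → ∑< (m ℕ.+ n) a ≈ ∑< m a + ∑< n (λ i → a (m ℕ.+ i))
  ∑<-+ m zero    a rewrite ℕₚ.+-identityʳ m = sym (+-identityʳ _)
  ∑<-+ m (suc n) a rewrite ℕₚ.+-suc m n = trans (+-congʳ (∑<-+ m n a)) (+-assoc _ _ _)

  ∑<-head : ∀ n (a : ℕ → Carrier) → ∑< (suc n) a ≈ a 0 + ∑< n (λ i → a (suc i))
  ∑<-head n a = trans (∑<-+ 1 n a) (+-congʳ (+-identityˡ (a 0)))

  ∑<-extend : ∀ {m n} (a : ℕ → Carrier) → m ≤ n → (∀ i → m ≤ i → i < n → a i ≈ 0#) → ∑< m a ≈ ∑< n a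
  ∑<-extend {m} {n} a m≤n a≈0 = begin
    ∑< m a                                    ≈⟨ +-identityʳ _ ⟨
    ∑< m a + 0#                               ≈⟨ +-congˡ (∑<-zero (n ∸ m) tail≈0) ⟨
    ∑< m a + ∑< (n ∸ m) (λ i → a (m ℕ.+ i))   ≈⟨ ∑<-+ m (n ∸ m) a ⟨
    ∑< (m ℕ.+ (n ∸ m)) a                      ≡⟨ ≡.cong (λ k → ∑< k a) (ℕₚ.m+[n∸m]≡n m≤n) ⟩
    ∑< n a                                    ∎
    where
    tail≈0 : ∀ i → i < n ∸ m → a (m ℕ.+ i) ≈ 0#
    tail≈0 i i<n∸m = a≈0 (m ℕ.+ i) (ℕₚ.m≤m+n m i)
                         (≡.subst (m ℕ.+ i <_) (ℕₚ.m+[n∸m]≡n m≤n) (ℕₚ.+-monoʳ-< m i<n∸m))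

  ∑<-reverse : ∀ n (a : ℕ → Carrier) → ∑< n a ≈ ∑< n (λ i → a (n ∸ suc i))
  ∑<-reverse zero    a = refl
  ∑<-reverse (suc n) a = begin
    ∑< n a + a n                         ≈⟨ +-comm _ _ ⟩
    a n + ∑< n a                         ≈⟨ +-congˡ (∑<-reverse n a) ⟩
    a n + ∑< n (λ i → a (n ∸ suc i))     ≈⟨ sym (∑<-head n _) ⟩
    ∑< (suc n) (λ i → a (suc n ∸ suc i)) ∎

  ∑<-comm : ∀ m n (f : ℕ → ℕ → Carrier) → ∑< m (λ i → ∑< n (f i)) ≈ ∑< n (λ j → ∑< m (λ i → f i j))
  ∑<-comm zero    n f = sym (∑<-zero n λ _ _ → refl)
  ∑<-comm (suc m) n f = trans (+-congʳ (∑<-comm m n f)) (sym (∑<-distrib-+ n _ _))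

  ∑<-single : ∀ n k (a : ℕ → Carrier) → k < n → (∀ i → i < n → i ≢ k → a i ≈ 0#) → ∑< n a ≈ a k
  ∑<-single (suc n) k a k<1+n a≈0 with k ≟ n
  ... | yes ≡.refl = trans (+-congʳ (∑<-zero n λ i i<n → a≈0 i (ℕₚ.m<n⇒m<1+n i<n) (ℕₚ.<⇒≢ i<n)))
                           (+-identityˡ _)
  ... | no k≢n     = trans (+-cong (∑<-single n k a (ℕₚ.≤∧≢⇒< (ℕₚ.≤-pred k<1+n) k≢n)
                                      λ i i<n → a≈0 i (ℕₚ.m<n⇒m<1+n i<n))
                                   (a≈0 n ℕₚ.≤-refl (k≢n ∘ ≡.sym)))
                           (+-identityʳ _)

  ∑<-triangle : ∀ n (F : ℕ → ℕ → Carrier) →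
                ∑< n (λ i → ∑< (suc i) (F i)) ≈ ∑< n (λ j → ∑< (n ∸ j) (λ k → F (j ℕ.+ k) j))
  ∑<-triangle zero    F = refl
  ∑<-triangle (suc n) F = begin
    ∑< n (λ i → ∑< (suc i) (F i)) + ∑< (suc n) (F n)
      ≈⟨ +-congʳ (trans (∑<-triangle n F) (sym (trans (+-congˡ lastColumnEmpty) (+-identityʳ _)))) ⟩
    ∑< (suc n) column + ∑< (suc n) (F n)
      ≈⟨ sym (∑<-distrib-+ (suc n) column (F n)) ⟩
    ∑< (suc n) (λ j → column j + F n j)
      ≈⟨ ∑<-cong (suc n) (λ j j<1+n → reflexive (extendColumn j (ℕₚ.≤-pred j<1+n))) ⟩
    ∑< (suc n) (λ j → ∑< (suc n ∸ j) (λ k → F (j ℕ.+ k) j)) ∎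
    where
    column : ℕ → Carrier
    column j = ∑< (n ∸ j) (λ k → F (j ℕ.+ k) j)
    lastColumnEmpty : column n ≈ 0#
    lastColumnEmpty = reflexive (≡.cong (λ m → ∑< m (λ k → F (n ℕ.+ k) n)) (ℕₚ.n∸n≡0 n))
    extendColumn : ∀ j → j ≤ n → column j + F n j ≡ ∑< (suc n ∸ j) (λ k → F (j ℕ.+ k) j)
    extendColumn j j≤n rewrite ℕₚ.+-∸-assoc 1 j≤n =
      ≡.cong (λ i → column j + F i j) (≡.sym (ℕₚ.m+[n∸m]≡n j≤n))

  ·-zeroʳ : ∀ n → n · 0# ≈ 0#
  ·-zeroʳ zero    = refl
  ·-zeroʳ (suc n) = trans (+-identityˡ _) (·-zeroʳ n)

  ·-distrib-∑< : ∀ k n (a : ℕ → Carrier) → k · ∑< n a ≈ ∑< n (λ i → k · a i)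
  ·-distrib-∑< k zero    a = ·-zeroʳ k
  ·-distrib-∑< k (suc n) a = trans (×-distrib-+ _ _ k) (+-congʳ (·-distrib-∑< k n a))
    where open import Algebra.Properties.CommutativeMonoid.Mult +-commutativeMonoid using (×-distrib-+)

  ·-interchange : ∀ k e x y → (k · x) * (e · y) ≈ (e ℕ.* k) · (x * y)
  ·-interchange k e x y = begin
    (k · x) * (e · y)     ≈⟨ ×-assoc-* k x (e · y) ⟩
    k · (x * (e · y))     ≈⟨ ×-congʳ k (×-comm-* e x y) ⟩
    k · (e · (x * y))     ≈⟨ ×-assocˡ (x * y) k e ⟩
    (k ℕ.* e) · (x * y)   ≡⟨ ≡.cong (_· (x * y)) (ℕₚ.*-comm k e) ⟩
    (e ℕ.* k) · (x * y)   ∎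
    where open import Algebra.Properties.Semiring.Mult semiring using (×-assoc-*; ×-comm-*; ×-congʳ; ×-assocˡ)

  -- ∑ᵗ m F sums F over [0, N)^m, whose elements are represented as lists of length m.
  module Tuples (N : ℕ) where

    ∑ᵗ : ℕ → (List ℕ → Carrier) → Carrier
    ∑ᵗ zero    F = F []
    ∑ᵗ (suc m) F = ∑< N (λ x → ∑ᵗ m (λ l → F (x ∷ l)))

    ∑ᵗ-cong : ∀ m {F G : List ℕ → Carrier} → (∀ l → length l ≡ m → All (_< N) l → F l ≈ G l) →
              ∑ᵗ m F ≈ ∑ᵗ m G
    ∑ᵗ-cong zero    F≈G = F≈G [] ≡.refl []
    ∑ᵗ-cong (suc m) F≈G = ∑<-cong N λ x x<N → ∑ᵗ-cong m λ l ∣l∣≡m l<N → F≈G (x ∷ l) (≡.cong suc ∣l∣≡m) (x<N ∷ l<N)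

    ∑ᵗ-zero : ∀ m {F : List ℕ → Carrier} → (∀ l → F l ≈ 0#) → ∑ᵗ m F ≈ 0#
    ∑ᵗ-zero zero    F≈0 = F≈0 []
    ∑ᵗ-zero (suc m) F≈0 = ∑<-zero N λ x _ → ∑ᵗ-zero m λ l → F≈0 (x ∷ l)

    ∑ᵗ-∑<-comm : ∀ m k (F : List ℕ → ℕ → Carrier) → ∑ᵗ m (λ l → ∑< k (F l)) ≈ ∑< k (λ i → ∑ᵗ m (λ l → F l i))
    ∑ᵗ-∑<-comm zero    k F = refl
    ∑ᵗ-∑<-comm (suc m) k F = trans (∑<-cong N λ x _ → ∑ᵗ-∑<-comm m k (λ l → F (x ∷ l))) (∑<-comm N k _)

    ∑ᵗ-comm : ∀ m m′ (F : List ℕ → List ℕ → Carrier) →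
              ∑ᵗ m (λ l → ∑ᵗ m′ (F l)) ≈ ∑ᵗ m′ (λ l′ → ∑ᵗ m (λ l → F l l′))
    ∑ᵗ-comm zero    m′ F = refl
    ∑ᵗ-comm (suc m) m′ F = trans (∑<-cong N λ x _ → ∑ᵗ-comm m m′ (λ l → F (x ∷ l)))
                                 (sym (∑ᵗ-∑<-comm m′ N λ l′ x → ∑ᵗ m (λ l → F (x ∷ l) l′)))

    *-distribˡ-∑ᵗ : ∀ m x (F : List ℕ → Carrier) → x * ∑ᵗ m F ≈ ∑ᵗ m (λ l → x * F l)
    *-distribˡ-∑ᵗ zero    x F = refl
    *-distribˡ-∑ᵗ (suc m) x F = trans (*-distribˡ-∑< N x _) (∑<-cong N λ y _ → *-distribˡ-∑ᵗ m x _)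

    ·-distrib-∑ᵗ : ∀ k m (F : List ℕ → Carrier) → k · ∑ᵗ m F ≈ ∑ᵗ m (λ l → k · F l)
    ·-distrib-∑ᵗ k zero    F = refl
    ·-distrib-∑ᵗ k (suc m) F = trans (·-distrib-∑< k N _) (∑<-cong N λ y _ → ·-distrib-∑ᵗ k m _)

    ∑ᵗ-snoc : ∀ m (F : List ℕ → Carrier) → ∑ᵗ (suc m) F ≈ ∑< N (λ x → ∑ᵗ m (λ l → F (l ++ [ x ])))
    ∑ᵗ-snoc zero    F = refl
    ∑ᵗ-snoc (suc m) F = trans (∑<-cong N λ y _ → ∑ᵗ-snoc m (λ l → F (y ∷ l))) (∑<-comm N N _)

    ∑ᵗ-rotate : ∀ m (F : List ℕ → Carrier) → ∑ᵗ m (F ∘ rotate) ≈ ∑ᵗ m F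
    ∑ᵗ-rotate zero    F = refl
    ∑ᵗ-rotate (suc m) F = sym (∑ᵗ-snoc m F)

    ∑ᵗ-select : ∀ m (G : List ℕ → Carrier) s → length s ≡ m → All (_< N) s →
                ∑ᵗ m (λ t → ⟦ does (t ≟ₗ s) ⟧ · G t) ≈ G s
    ∑ᵗ-select zero    G []      ≡.refl []         = +-identityʳ (G [])
    ∑ᵗ-select (suc m) G (y ∷ s) ∣s∣≡m  (y<N ∷ s<N) = begin
      ∑< N (λ x → ∑ᵗ m (λ t → ⟦ (x ≡ᵇ y) ∧ does (t ≟ₗ s) ⟧ · G (x ∷ t)))
        ≈⟨ ∑<-single N y _ y<N (λ x _ x≢y → ∑ᵗ-zero m λ t →
             reflexive (≡.cong (λ b → ⟦ b ∧ does (t ≟ₗ s) ⟧ · G (x ∷ t)) (dec-false (x ≟ y) x≢y))) ⟩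
      ∑ᵗ m (λ t → ⟦ (y ≡ᵇ y) ∧ does (t ≟ₗ s) ⟧ · G (y ∷ t))
        ≡⟨ ≡.cong (λ b → ∑ᵗ m (λ t → ⟦ b ∧ does (t ≟ₗ s) ⟧ · G (y ∷ t))) (dec-true (y ≟ y) ≡.refl) ⟩
      ∑ᵗ m (λ t → ⟦ does (t ≟ₗ s) ⟧ · G (y ∷ t))
        ≈⟨ ∑ᵗ-select m (G ∘ (y ∷_)) s (ℕₚ.suc-injective ∣s∣≡m) s<N ⟩
      G (y ∷ s) ∎

module ℕSums = Sums ℕₚ.+-*-commutativeSemiring

sum≡∑<-entry : ∀ l → sum l ≡ ℕSums.∑< (length l) (entry l)
sum≡∑<-entry []      = ≡.refl
sum≡∑<-entry (x ∷ l) = ≡.trans (≡.cong (x ℕ.+_) (sum≡∑<-entry l)) (≡.sym (ℕSums.∑<-head (length l) (entry (x ∷ l))))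

module _ (N : ℕ) where
  open ℕSums
  open Tuples N

  -- By rotation invariance every position j carries the same total Y j, and Σ_j Y j = m Σ X.
  ∑ᵗ-head-average : ∀ p (X : List ℕ → ℕ) → (∀ l → X (rotate l) ≡ X l) →
                    (∀ l → X l ℕ.* sum l ≡ X l ℕ.* suc p) →
                    ∑ᵗ (suc p) (λ l → X l ℕ.* entry l 0) ≡ ∑ᵗ (suc p) X
  ∑ᵗ-head-average p X X∘rotate≗X X-supported = ℕₚ.*-cancelˡ-≡ _ _ m (begin
    m ℕ.* Y 0                                  ≡⟨ ∑<-const m (Y 0) ⟨
    ∑< m (λ _ → Y 0)                           ≡⟨ ∑<-cong m Y-constant ⟨
    ∑< m Y                                     ≡⟨ ∑ᵗ-∑<-comm m m (λ l j → X l ℕ.* entry l j) ⟨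
    ∑ᵗ m (λ l → ∑< m (λ j → X l ℕ.* entry l j)) ≡⟨ ∑ᵗ-cong m (λ l ∣l∣≡m _ → total l ∣l∣≡m) ⟩
    ∑ᵗ m (λ l → m ℕ.* X l)                     ≡⟨ *-distribˡ-∑ᵗ m m X ⟨
    m ℕ.* ∑ᵗ m X                               ∎)
    where
    open ≡.≡-Reasoning
    m : ℕ
    m = suc p
    Y : ℕ → ℕ
    Y j = ∑ᵗ m (λ l → X l ℕ.* entry l j)

    ∑<-const : ∀ n c → ∑< n (λ _ → c) ≡ n ℕ.* c
    ∑<-const zero    c = ≡.refl
    ∑<-const (suc n) c = ≡.trans (≡.cong (ℕ._+ c) (∑<-const n c)) (ℕₚ.+-comm (n ℕ.* c) c)

    Y-suc : ∀ j → j < p → Y (suc j) ≡ Y j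
    Y-suc j j<p = ≡.trans (∑ᵗ-cong m shift) (∑ᵗ-rotate m (λ l → X l ℕ.* entry l j))
      where
      shift : ∀ l → length l ≡ m → All (_< N) l → X l ℕ.* entry l (suc j) ≡ X (rotate l) ℕ.* entry (rotate l) j
      shift (x ∷ l) ∣l∣≡m _ = ≡.cong₂ ℕ._*_ (≡.sym (X∘rotate≗X (x ∷ l)))
        (≡.sym (entry-++ l [ x ] j (≡.subst (j <_) (≡.sym (ℕₚ.suc-injective ∣l∣≡m)) j<p)))

    Y-constant : ∀ j → j < m → Y j ≡ Y 0
    Y-constant zero    _       = ≡.refl
    Y-constant (suc j) j+1<m = ≡.trans (Y-suc j (ℕₚ.≤-pred j+1<m)) (Y-constant j (ℕₚ.m<n⇒m<1+n (ℕₚ.≤-pred j+1<m)))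

    total : ∀ l → length l ≡ m → ∑< m (λ j → X l ℕ.* entry l j) ≡ m ℕ.* X l
    total l ∣l∣≡m = begin
      ∑< m (λ j → X l ℕ.* entry l j) ≡⟨ *-distribˡ-∑< m (X l) (entry l) ⟨
      X l ℕ.* ∑< m (entry l)         ≡⟨ ≡.cong (λ k → X l ℕ.* ∑< k (entry l)) ∣l∣≡m ⟨
      X l ℕ.* ∑< (length l) (entry l) ≡⟨ ≡.cong (X l ℕ.*_) (sum≡∑<-entry l) ⟨
      X l ℕ.* sum l                  ≡⟨ X-supported l ⟩
      X l ℕ.* m                      ≡⟨ ℕₚ.*-comm (X l) m ⟩
      m ℕ.* X l                      ∎

module ScaledSums {c ℓ} (S : CommutativeSemiring c ℓ) where
  open CommutativeSemiring S
  open Sums S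
  open import Algebra.Properties.Monoid.Mult +-monoid using (×-homo-+)

  ∑<-· : ∀ n (A : ℕ → ℕ) x → ℕSums.∑< n A · x ≈ ∑< n (λ i → A i · x)
  ∑<-· zero    A x = refl
  ∑<-· (suc n) A x = trans (×-homo-+ x (ℕSums.∑< n A) (A n)) (+-congʳ (∑<-· n A x))

  module _ (N : ℕ) where
    open Tuples N
    open ℕSums.Tuples N using () renaming (∑ᵗ to ∑ᵗℕ)

    ∑ᵗ-· : ∀ m (A : List ℕ → ℕ) x → ∑ᵗℕ m A · x ≈ ∑ᵗ m (λ l → A l · x)
    ∑ᵗ-· zero    A x = refl
    ∑ᵗ-· (suc m) A x = trans (∑<-· N _ x) (∑<-cong N λ y _ → ∑ᵗ-· m _ x)

module PowerSeries {c ℓ} (R : CommutativeRing c ℓ) where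
  open CommutativeRing R
  open FPS R
  open Sums commutativeSemiring
  open import Relation.Binary.Reasoning.Setoid setoid

  sumTo≡∑< : ∀ n a → sumTo n a ≡ ∑< n a
  sumTo≡∑< zero    a = ≡.refl
  sumTo≡∑< (suc n) a = ≡.cong (_+ a n) (sumTo≡∑< n a)

  natMul≡· : ∀ n x → natMul n x ≡ n · x
  natMul≡· zero    x = ≡.refl
  natMul≡· (suc n) x = ≡.cong (x +_) (natMul≡· n x)

  infix 4 _≐_
  _≐_ : Series → Series → Set ℓ
  a ≐ b = ∀ n → a n ≈ b n

  one : Series
  one = const 1#

  ⋆-coeff : ∀ a b n → (a ⋆ b) n ≈ ∑< (suc n) (λ i → a i * b (n ∸ i))
  ⋆-coeff a b n = reflexive (sumTo≡∑< (suc n) _)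

  ⋆-cong : ∀ {a a′ b b′} → a ≐ a′ → b ≐ b′ → a ⋆ b ≐ a′ ⋆ b′
  ⋆-cong {a} {a′} {b} {b′} a≐a′ b≐b′ n = begin
    (a ⋆ b) n                                 ≈⟨ ⋆-coeff a b n ⟩
    ∑< (suc n) (λ i → a i * b (n ∸ i))        ≈⟨ ∑<-cong (suc n) (λ i _ → *-cong (a≐a′ i) (b≐b′ (n ∸ i))) ⟩
    ∑< (suc n) (λ i → a′ i * b′ (n ∸ i))      ≈⟨ ⋆-coeff a′ b′ n ⟨
    (a′ ⋆ b′) n                               ∎

  ⋆-comm : ∀ a b → a ⋆ b ≐ b ⋆ a
  ⋆-comm a b n = begin
    (a ⋆ b) n                                         ≈⟨ ⋆-coeff a b n ⟩
    ∑< (suc n) (λ i → a i * b (n ∸ i))                ≈⟨ ∑<-reverse (suc n) _ ⟩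
    ∑< (suc n) (λ i → a (n ∸ i) * b (n ∸ (n ∸ i)))    ≈⟨ ∑<-cong (suc n) (λ i i<1+n →
                                                           trans (*-comm _ _) (*-congʳ (reflexive (≡.cong b (ℕₚ.m∸[m∸n]≡n (ℕₚ.≤-pred i<1+n)))))) ⟩
    ∑< (suc n) (λ i → b i * a (n ∸ i))                ≈⟨ ⋆-coeff b a n ⟨
    (b ⋆ a) n                                         ∎

  ⋆-assoc : ∀ a b d → (a ⋆ b) ⋆ d ≐ a ⋆ (b ⋆ d)
  ⋆-assoc a b d n = begin
    ((a ⋆ b) ⋆ d) n
      ≈⟨ ⋆-coeff (a ⋆ b) d n ⟩
    ∑< (suc n) (λ i → (a ⋆ b) i * d (n ∸ i))
      ≈⟨ ∑<-cong (suc n) (λ i _ → trans (*-congʳ (⋆-coeff a b i)) (*-distribʳ-∑< (suc i) _ _)) ⟩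
    ∑< (suc n) (λ i → ∑< (suc i) (λ j → a j * b (i ∸ j) * d (n ∸ i)))
      ≈⟨ ∑<-triangle (suc n) (λ i j → a j * b (i ∸ j) * d (n ∸ i)) ⟩
    ∑< (suc n) (λ j → ∑< (suc n ∸ j) (λ k → a j * b (j ℕ.+ k ∸ j) * d (n ∸ (j ℕ.+ k))))
      ≈⟨ ∑<-cong (suc n) (λ j j<1+n → row j (ℕₚ.≤-pred j<1+n)) ⟩
    ∑< (suc n) (λ j → a j * (b ⋆ d) (n ∸ j))
      ≈⟨ ⋆-coeff a (b ⋆ d) n ⟨
    (a ⋆ (b ⋆ d)) n ∎
    where
    row : ∀ j → j ≤ n → ∑< (suc n ∸ j) (λ k → a j * b (j ℕ.+ k ∸ j) * d (n ∸ (j ℕ.+ k))) ≈ a j * (b ⋆ d) (n ∸ j)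
    row j j≤n = begin
      ∑< (suc n ∸ j) (λ k → a j * b (j ℕ.+ k ∸ j) * d (n ∸ (j ℕ.+ k)))
        ≡⟨ ≡.cong (λ m → ∑< m (λ k → a j * b (j ℕ.+ k ∸ j) * d (n ∸ (j ℕ.+ k)))) (ℕₚ.+-∸-assoc 1 j≤n) ⟩
      ∑< (suc (n ∸ j)) (λ k → a j * b (j ℕ.+ k ∸ j) * d (n ∸ (j ℕ.+ k)))
        ≈⟨ ∑<-cong (suc (n ∸ j)) (λ k _ → trans (*-assoc _ _ _) (*-congˡ (reflexive
             (≡.cong₂ (λ p q → b p * d q) (ℕₚ.m+n∸m≡n j k) (≡.sym (ℕₚ.∸-+-assoc n j k)))))) ⟩
      ∑< (suc (n ∸ j)) (λ k → a j * (b k * d (n ∸ j ∸ k)))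
        ≈⟨ *-distribˡ-∑< (suc (n ∸ j)) (a j) _ ⟨
      a j * ∑< (suc (n ∸ j)) (λ k → b k * d (n ∸ j ∸ k))
        ≈⟨ *-congˡ (⋆-coeff b d (n ∸ j)) ⟨
      a j * (b ⋆ d) (n ∸ j) ∎

  ⋆-identityˡ : ∀ a → one ⋆ a ≐ a
  ⋆-identityˡ a n = begin
    (one ⋆ a) n                                          ≈⟨ ⋆-coeff one a n ⟩
    ∑< (suc n) (λ i → one i * a (n ∸ i))                 ≈⟨ ∑<-head n _ ⟩
    1# * a n + ∑< n (λ i → 0# * a (n ∸ suc i))           ≈⟨ +-cong (*-identityˡ (a n)) (∑<-zero n (λ i _ → zeroˡ _)) ⟩
    a n + 0#                                             ≈⟨ +-identityʳ (a n) ⟩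
    a n                                                  ∎

  ⋆-commutativeMonoid : CommutativeMonoid c ℓ
  ⋆-commutativeMonoid = record
    { Carrier = Series
    ; _≈_ = _≐_
    ; _∙_ = _⋆_
    ; ε = one
    ; isCommutativeMonoid = record
      { isMonoid = record
        { isSemigroup = record
          { isMagma = record
            { isEquivalence = record
              { refl = λ _ → refl ; sym = λ p n → sym (p n) ; trans = λ p q n → trans (p n) (q n) }
            ; ∙-cong = ⋆-cong }
          ; assoc = ⋆-assoc }
        ; identity = ⋆-identityˡ , λ a → λ n → trans (⋆-comm a one n) (⋆-identityˡ a n) }
      ; comm = ⋆-comm } }

  open CommutativeMonoid ⋆-commutativeMonoid public
    using () renaming (refl to ≐-refl; sym to ≐-sym; trans to ≐-trans)
  open import Algebra.Properties.CommutativeSemigroup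
    (CommutativeMonoid.commutativeSemigroup ⋆-commutativeMonoid) public
    using () renaming (interchange to ⋆-interchange; x∙yz≈y∙xz to ⋆-leftComm)
  open import Algebra.Properties.CommutativeMonoid.Mult ⋆-commutativeMonoid using ()
    renaming (_×_ to _×⋆_; ×-congʳ to ×⋆-congʳ; ×-homo-+ to ×⋆-homo-+; ×-distrib-+ to ×⋆-distrib-⋆)

  pow≡×⋆ : ∀ a k → pow a k ≡ k ×⋆ a
  pow≡×⋆ a zero    = ≡.refl
  pow≡×⋆ a (suc k) = ≡.cong (a ⋆_) (pow≡×⋆ a k)

  pow-cong : ∀ k {a b} → a ≐ b → pow a k ≐ pow b k
  pow-cong k {a} {b} rewrite pow≡×⋆ a k | pow≡×⋆ b k = ×⋆-congʳ k

  pow-+ : ∀ a m k → pow a (m ℕ.+ k) ≐ pow a m ⋆ pow a k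
  pow-+ a m k rewrite pow≡×⋆ a (m ℕ.+ k) | pow≡×⋆ a m | pow≡×⋆ a k = ×⋆-homo-+ a m k

  pow-⋆ : ∀ a b k → pow (a ⋆ b) k ≐ pow a k ⋆ pow b k
  pow-⋆ a b k rewrite pow≡×⋆ (a ⋆ b) k | pow≡×⋆ a k | pow≡×⋆ b k = ×⋆-distrib-⋆ a b k

  pow-one : ∀ k → pow one k ≐ one
  pow-one zero    = ≐-refl
  pow-one (suc k) = ≐-trans (⋆-cong ≐-refl (pow-one k)) (⋆-identityˡ one)

  ⋆-coeff₀ : ∀ a b → (a ⋆ b) 0 ≈ a 0 * b 0
  ⋆-coeff₀ a b = +-identityˡ (a 0 * b 0)

  pow-coeff₀-invertible : ∀ {u a} → u * a 0 ≈ 1# → ∀ k → ∃ λ y → y * pow a k 0 ≈ 1#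
  pow-coeff₀-invertible         ua≈1 zero    = 1# , *-identityˡ 1#
  pow-coeff₀-invertible {u} {a} ua≈1 (suc k) with pow-coeff₀-invertible ua≈1 k
  ... | y , y*aᵏ≈1 = u * y , (begin
    (u * y) * (a ⋆ pow a k) 0       ≈⟨ *-congˡ (⋆-coeff₀ a (pow a k)) ⟩
    (u * y) * (a 0 * pow a k 0)     ≈⟨ interchange u y (a 0) (pow a k 0) ⟩
    (u * a 0) * (y * pow a k 0)     ≈⟨ *-cong ua≈1 y*aᵏ≈1 ⟩
    1# * 1#                         ≈⟨ *-identityˡ 1# ⟩
    1#                              ∎)
    where open import Algebra.Properties.CommutativeSemigroup *-commutativeSemigroup using (interchange)

  X⋆-zero : ∀ a → (X ⋆ a) 0 ≈ 0#
  X⋆-zero a = trans (⋆-coeff₀ X a) (zeroˡ (a 0))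

  X⋆-suc : ∀ a n → (X ⋆ a) (suc n) ≈ a n
  X⋆-suc a n = begin
    (X ⋆ a) (suc n)                                        ≈⟨ ⋆-coeff X a (suc n) ⟩
    ∑< (suc (suc n)) (λ i → X i * a (suc n ∸ i))          ≈⟨ ∑<-head (suc n) _ ⟩
    0# * a (suc n) + ∑< (suc n) (λ i → X (suc i) * a (n ∸ i)) ≈⟨ +-cong (zeroˡ _) (∑<-head n _) ⟩
    0# + (1# * a n + ∑< n (λ i → 0# * a (n ∸ suc i)))      ≈⟨ +-identityˡ _ ⟩
    1# * a n + ∑< n (λ i → 0# * a (n ∸ suc i))             ≈⟨ +-cong (*-identityˡ (a n)) (∑<-zero n (λ i _ → zeroˡ _)) ⟩
    a n + 0#                                               ≈⟨ +-identityʳ (a n) ⟩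
    a n                                                    ∎

  pow-X⋆-shift : ∀ k a r → (pow X k ⋆ a) (k ℕ.+ r) ≈ a r
  pow-X⋆-shift zero    a r = ⋆-identityˡ a r
  pow-X⋆-shift (suc k) a r = trans (⋆-assoc X (pow X k) a (suc k ℕ.+ r))
                                   (trans (X⋆-suc (pow X k ⋆ a) (k ℕ.+ r)) (pow-X⋆-shift k a r))

  pow-X⋆-below : ∀ k a r → r < k → (pow X k ⋆ a) r ≈ 0#
  pow-X⋆-below (suc k) a zero    _     = trans (⋆-assoc X (pow X k) a 0) (X⋆-zero (pow X k ⋆ a))
  pow-X⋆-below (suc k) a (suc r) r<1+k = trans (⋆-assoc X (pow X k) a (suc r))
                                          (trans (X⋆-suc (pow X k ⋆ a) r) (pow-X⋆-below k a r (ℕₚ.≤-pred r<1+k)))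

  infixl 6 _⊕_
  _⊕_ : Series → Series → Series
  (a ⊕ b) n = a n + b n

  ⋆-distribʳ : ∀ a b d → (b ⊕ d) ⋆ a ≐ (b ⋆ a) ⊕ (d ⋆ a)
  ⋆-distribʳ a b d n = begin
    ((b ⊕ d) ⋆ a) n                                            ≈⟨ ⋆-coeff (b ⊕ d) a n ⟩
    ∑< (suc n) (λ i → (b i + d i) * a (n ∸ i))                 ≈⟨ ∑<-cong (suc n) (λ i _ → distribʳ _ _ _) ⟩
    ∑< (suc n) (λ i → b i * a (n ∸ i) + d i * a (n ∸ i))       ≈⟨ ∑<-distrib-+ (suc n) _ _ ⟩
    ∑< (suc n) (λ i → b i * a (n ∸ i)) + ∑< (suc n) (λ i → d i * a (n ∸ i))
                                                               ≈⟨ +-cong (⋆-coeff b a n) (⋆-coeff d a n) ⟨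
    ((b ⋆ a) ⊕ (d ⋆ a)) n                                      ∎

  invStep-stable : ∀ h u {m n} → m ≤ n → invStep h u n m ≡ invSeries h u m
  invStep-stable h u {n = zero}  z≤n = ≡.refl
  invStep-stable h u {m} {suc n} m≤1+n with ℕₚ.m≤n⇒m<n∨m≡n m≤1+n
  ... | inj₁ m<1+n rewrite dec-true (m ≤? n) (ℕₚ.≤-pred m<1+n) = invStep-stable h u (ℕₚ.≤-pred m<1+n)
  ... | inj₂ ≡.refl = ≡.refl

  invSeries-inverse : ∀ h u → u * h 0 ≈ 1# → h ⋆ invSeries h u ≐ one
  invSeries-inverse h u uh₀≈1 zero    = trans (⋆-coeff₀ h (invSeries h u)) (trans (*-comm (h 0) u) uh₀≈1)
  invSeries-inverse h u uh₀≈1 (suc n) = begin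
    (h ⋆ g) (suc n)                               ≈⟨ ⋆-coeff h g (suc n) ⟩
    ∑< (suc (suc n)) (λ i → h i * g (suc n ∸ i))  ≈⟨ ∑<-head (suc n) _ ⟩
    h 0 * g (suc n) + S                           ≈⟨ +-congʳ (*-congˡ g₁₊ₙ≈-uS) ⟩
    h 0 * - (u * S) + S                           ≈⟨ +-congʳ (-‿distribʳ-* (h 0) (u * S)) ⟨
    - (h 0 * (u * S)) + S                         ≈⟨ +-congʳ (-‿cong h₀uS≈S) ⟩
    - S + S                                       ≈⟨ -‿inverseˡ S ⟩
    0#                                            ∎
    where
    open import Algebra.Properties.Ring ring using (-‿distribʳ-*)
    g : Series
    g = invSeries h u
    S : Carrier
    S = ∑< (suc n) (λ i → h (suc i) * g (n ∸ i))
    h₀uS≈S : h 0 * (u * S) ≈ S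
    h₀uS≈S = begin
      h 0 * (u * S)  ≈⟨ *-assoc (h 0) u S ⟨
      (h 0 * u) * S  ≈⟨ *-congʳ (trans (*-comm (h 0) u) uh₀≈1) ⟩
      1# * S         ≈⟨ *-identityˡ S ⟩
      S              ∎
    g₁₊ₙ≈-uS : g (suc n) ≈ - (u * S)
    g₁₊ₙ≈-uS rewrite dec-false (suc n ≤? n) (ℕₚ.<-irrefl ≡.refl) =
      -‿cong (*-congˡ (trans (reflexive (sumTo≡∑< (suc n) _))
        (∑<-cong (suc n) λ j _ → *-congˡ (reflexive (invStep-stable h u (ℕₚ.m∸n≤m n j))))))

  module Expansion (h : Series) (N : ℕ) where
    open Tuples N
    open ℕSums.Tuples N using () renaming (∑ᵗ to ∑ᵗℕ)
    open import Algebra.Properties.Semiring.Mult semiring using (×-comm-*; ×-congʳ; ×-assocˡ)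
    open ScaledSums commutativeSemiring using (∑ᵗ-·)

    weight : List ℕ → Carrier
    weight l = foldr _*_ 1# (map h l)

    weight-↭ : ∀ {l l′} → l ↭ l′ → weight l ≈ weight l′
    weight-↭ l↭l′ = foldr-commMonoid *-isCommutativeMonoid (↭⇒↭ₛ′ isEquivalence (↭ₚ.map⁺ h l↭l′))
      where open import Data.List.Relation.Binary.Permutation.Setoid.Properties setoid using (foldr-commMonoid)

    pow-coeff-expansion : ∀ m n → n < N → pow h m n ≈ ∑ᵗ m (λ l → ⟦ sum l ≡ᵇ n ⟧ · weight l)
    pow-coeff-expansion zero    zero    _   = sym (+-identityʳ 1#)
    pow-coeff-expansion zero    (suc n) _   = refl
    pow-coeff-expansion (suc m) n       n<N = begin
      pow h (suc m) n                           ≈⟨ ⋆-coeff h (pow h m) n ⟩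
      ∑< (suc n) (λ i → h i * pow h m (n ∸ i))  ≈⟨ ∑<-cong (suc n) (λ i i<1+n → term i (ℕₚ.≤-pred i<1+n)) ⟩
      ∑< (suc n) F                              ≈⟨ ∑<-extend F n<N (λ i n<i _ → ∑ᵗ-zero m λ l →
                                                     reflexive (≡.cong (λ b → ⟦ b ⟧ · (h i * weight l)) (+-≡ᵇ-overshoot (sum l) n<i))) ⟩
      ∑< N F                                    ∎
      where
      F : ℕ → Carrier
      F i = ∑ᵗ m (λ l → ⟦ i ℕ.+ sum l ≡ᵇ n ⟧ · (h i * weight l))
      term : ∀ i → i ≤ n → h i * pow h m (n ∸ i) ≈ F i
      term i i≤n = begin
        h i * pow h m (n ∸ i)
          ≈⟨ *-congˡ (pow-coeff-expansion m (n ∸ i) (ℕₚ.≤-<-trans (ℕₚ.m∸n≤m n i) n<N)) ⟩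
        h i * ∑ᵗ m (λ l → ⟦ sum l ≡ᵇ n ∸ i ⟧ · weight l)
          ≈⟨ *-distribˡ-∑ᵗ m (h i) _ ⟩
        ∑ᵗ m (λ l → h i * (⟦ sum l ≡ᵇ n ∸ i ⟧ · weight l))
          ≈⟨ ∑ᵗ-cong m (λ l _ _ → trans (×-comm-* ⟦ sum l ≡ᵇ n ∸ i ⟧ (h i) (weight l))
               (reflexive (≡.cong (λ b → ⟦ b ⟧ · (h i * weight l)) (≡.sym (+-≡ᵇ-∸ (sum l) i≤n))))) ⟩
        F i ∎

    -- Tuples with the same sorted form have the same weight, so identities between the ℕ-valued
    -- counts on the right (provable in ℕ, where m cancels) transfer to weighted sums.
    ∑ᵗ-regroup-by-sort : ∀ m (a : List ℕ → ℕ) →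
      ∑ᵗ m (λ l → a l · weight l) ≈ ∑ᵗ m (λ t → ∑ᵗℕ m (λ l → a l ℕ.* ⟦ does (t ≟ₗ sort l) ⟧) · weight t)
    ∑ᵗ-regroup-by-sort m a = begin
      ∑ᵗ m (λ l → a l · weight l)
        ≈⟨ ∑ᵗ-cong m (λ l ∣l∣≡m l<N → ×-congʳ (a l) (sym (select l ∣l∣≡m l<N))) ⟩
      ∑ᵗ m (λ l → a l · ∑ᵗ m (λ t → ⟦ does (t ≟ₗ sort l) ⟧ · weight t))
        ≈⟨ ∑ᵗ-cong m (λ l _ _ → trans (·-distrib-∑ᵗ (a l) m _) (∑ᵗ-cong m λ t _ _ → ×-assocˡ (weight t) (a l) _)) ⟩
      ∑ᵗ m (λ l → ∑ᵗ m (λ t → (a l ℕ.* ⟦ does (t ≟ₗ sort l) ⟧) · weight t))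
        ≈⟨ ∑ᵗ-comm m m _ ⟩
      ∑ᵗ m (λ t → ∑ᵗ m (λ l → (a l ℕ.* ⟦ does (t ≟ₗ sort l) ⟧) · weight t))
        ≈⟨ ∑ᵗ-cong m (λ t _ _ → ∑ᵗ-· N m _ (weight t)) ⟨
      ∑ᵗ m (λ t → ∑ᵗℕ m (λ l → a l ℕ.* ⟦ does (t ≟ₗ sort l) ⟧) · weight t) ∎
      where
      select : ∀ l → length l ≡ m → All (_< N) l → ∑ᵗ m (λ t → ⟦ does (t ≟ₗ sort l) ⟧ · weight t) ≈ weight l
      select l ∣l∣≡m l<N = trans
        (∑ᵗ-select m weight (sort l) (≡.trans (↭ₚ.↭-length (sort-↭ l)) ∣l∣≡m) (↭ₚ.All-resp-↭ (↭.↭-sym (sort-↭ l)) l<N))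
        (weight-↭ (sort-↭ l))

    ∑ᵗ-weighted-head-average : ∀ p →
      ∑ᵗ (suc p) (λ l → (⟦ sum l ≡ᵇ suc p ⟧ ℕ.* entry l 0) · weight l) ≈ ∑ᵗ (suc p) (λ l → ⟦ sum l ≡ᵇ suc p ⟧ · weight l)
    ∑ᵗ-weighted-head-average p = begin
      ∑ᵗ m (λ l → (⟦ sum l ≡ᵇ m ⟧ ℕ.* entry l 0) · weight l)
        ≈⟨ ∑ᵗ-regroup-by-sort m (λ l → ⟦ sum l ≡ᵇ m ⟧ ℕ.* entry l 0) ⟩
      ∑ᵗ m (λ t → ∑ᵗℕ m (λ l → (⟦ sum l ≡ᵇ m ⟧ ℕ.* entry l 0) ℕ.* ⟦ does (t ≟ₗ sort l) ⟧) · weight t)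
        ≈⟨ ∑ᵗ-cong m (λ t _ _ → reflexive (≡.cong (_· weight t) (class-count t))) ⟩
      ∑ᵗ m (λ t → ∑ᵗℕ m (λ l → ⟦ sum l ≡ᵇ m ⟧ ℕ.* ⟦ does (t ≟ₗ sort l) ⟧) · weight t)
        ≈⟨ ∑ᵗ-regroup-by-sort m (λ l → ⟦ sum l ≡ᵇ m ⟧) ⟨
      ∑ᵗ m (λ l → ⟦ sum l ≡ᵇ m ⟧ · weight l) ∎
      where
      open import Algebra.Properties.CommutativeSemigroup ℕₚ.*-commutativeSemigroup using (xy∙z≈xz∙y)
      m : ℕ
      m = suc p
      class-count : ∀ t → ∑ᵗℕ m (λ l → (⟦ sum l ≡ᵇ m ⟧ ℕ.* entry l 0) ℕ.* ⟦ does (t ≟ₗ sort l) ⟧)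
                        ≡ ∑ᵗℕ m (λ l → ⟦ sum l ≡ᵇ m ⟧ ℕ.* ⟦ does (t ≟ₗ sort l) ⟧)
      class-count t = ≡.trans (ℕSums.Tuples.∑ᵗ-cong N m (λ l _ _ → xy∙z≈xz∙y ⟦ sum l ≡ᵇ m ⟧ (entry l 0) ⟦ does (t ≟ₗ sort l) ⟧))
                              (∑ᵗ-head-average N p χ χ∘rotate≗χ χ-supported)
        where
        χ : List ℕ → ℕ
        χ l = ⟦ sum l ≡ᵇ m ⟧ ℕ.* ⟦ does (t ≟ₗ sort l) ⟧
        χ∘rotate≗χ : ∀ l → χ (rotate l) ≡ χ l
        χ∘rotate≗χ l = ≡.cong₂ (λ s k → ⟦ s ≡ᵇ m ⟧ ℕ.* ⟦ does (t ≟ₗ k) ⟧)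
                                (sum-↭ (rotate-↭ l)) (sort-cong-↭ (rotate-↭ l))
        χ-supported : ∀ l → χ l ℕ.* sum l ≡ χ l ℕ.* m
        χ-supported l with sum l ≟ m
        ... | yes s≡m = ≡.cong (χ l ℕ.*_) s≡m
        ... | no  s≢m rewrite dec-false (sum l ≟ m) s≢m = ≡.refl

  module _ (h : Series) (p : ℕ) where
    open Tuples (suc (suc p))
    open Expansion h (suc (suc p))

    deriv⋆pow-coeff-expansion :
      (deriv h ⋆ pow h p) p ≈ ∑ᵗ (suc p) (λ l → (⟦ sum l ≡ᵇ suc p ⟧ ℕ.* entry l 0) · weight l)
    deriv⋆pow-coeff-expansion = begin
      (deriv h ⋆ pow h p) p                          ≈⟨ ⋆-coeff (deriv h) (pow h p) p ⟩
      ∑< (suc p) (λ i → deriv h i * pow h p (p ∸ i)) ≈⟨ ∑<-cong (suc p) (λ i i<1+p → term i (ℕₚ.≤-pred i<1+p)) ⟩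
      ∑< (suc p) (λ i → F (suc i))                   ≈⟨ +-identityˡ _ ⟨
      0# + ∑< (suc p) (λ i → F (suc i))              ≈⟨ +-congʳ F₀≈0 ⟨
      F 0 + ∑< (suc p) (λ i → F (suc i))             ≈⟨ ∑<-head (suc p) F ⟨
      ∑< (suc (suc p)) F                             ∎
      where
      F : ℕ → Carrier
      F x = ∑ᵗ p (λ l → (⟦ x ℕ.+ sum l ≡ᵇ suc p ⟧ ℕ.* x) · (h x * weight l))
      F₀≈0 : F 0 ≈ 0#
      F₀≈0 = ∑ᵗ-zero p (λ l → reflexive (≡.cong (_· (h 0 * weight l)) (ℕₚ.*-zeroʳ ⟦ sum l ≡ᵇ suc p ⟧)))
      term : ∀ i → i ≤ p → deriv h i * pow h p (p ∸ i) ≈ F (suc i)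
      term i i≤p = begin
        deriv h i * pow h p (p ∸ i)
          ≈⟨ *-cong (reflexive (natMul≡· (suc i) (h (suc i))))
                    (pow-coeff-expansion p (p ∸ i) (ℕₚ.≤-<-trans (ℕₚ.m∸n≤m p i) (ℕₚ.m<n⇒m<1+n (ℕₚ.n<1+n p)))) ⟩
        (suc i · h (suc i)) * ∑ᵗ p (λ l → ⟦ sum l ≡ᵇ p ∸ i ⟧ · weight l)
          ≈⟨ *-distribˡ-∑ᵗ p _ _ ⟩
        ∑ᵗ p (λ l → (suc i · h (suc i)) * (⟦ sum l ≡ᵇ p ∸ i ⟧ · weight l))
          ≈⟨ ∑ᵗ-cong p (λ l _ _ → trans (·-interchange (suc i) ⟦ sum l ≡ᵇ p ∸ i ⟧ (h (suc i)) (weight l))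
               (reflexive (≡.cong (λ b → (⟦ b ⟧ ℕ.* suc i) · (h (suc i) * weight l)) (≡.sym (+-≡ᵇ-∸ (sum l) i≤p))))) ⟩
        F (suc i) ∎

    pow-diagonal≈deriv⋆pow : pow h (suc p) (suc p) ≈ (deriv h ⋆ pow h p) p
    pow-diagonal≈deriv⋆pow = begin
      pow h (suc p) (suc p)                                              ≈⟨ pow-coeff-expansion (suc p) (suc p) ℕₚ.≤-refl ⟩
      ∑ᵗ (suc p) (λ l → ⟦ sum l ≡ᵇ suc p ⟧ · weight l)                   ≈⟨ ∑ᵗ-weighted-head-average p ⟨
      ∑ᵗ (suc p) (λ l → (⟦ sum l ≡ᵇ suc p ⟧ ℕ.* entry l 0) · weight l)   ≈⟨ deriv⋆pow-coeff-expansion ⟨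
      (deriv h ⋆ pow h p) p                                              ∎

  infix 4 _≈ₘ_
  _≈ₘ_ : Matrix → Matrix → Set ℓ
  M ≈ₘ M′ = ∀ n k → M n k ≈ M′ n k

  LowerTriangular : Matrix → Set ℓ
  LowerTriangular M = ∀ {i j} → i < j → M i j ≈ 0#

  ⊗-coeff : ∀ A B n k → (A ⊗ B) n k ≈ ∑< (suc n) (λ j → A n j * B j k)
  ⊗-coeff A B n k = reflexive (sumTo≡∑< (suc n) _)

  ⊗-congˡ : ∀ {A A′} B → A ≈ₘ A′ → A ⊗ B ≈ₘ A′ ⊗ B
  ⊗-congˡ {A} {A′} B A≈A′ n k = begin
    (A ⊗ B) n k                              ≈⟨ ⊗-coeff A B n k ⟩
    ∑< (suc n) (λ j → A n j * B j k)         ≈⟨ ∑<-cong (suc n) (λ j _ → *-congʳ (A≈A′ n j)) ⟩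
    ∑< (suc n) (λ j → A′ n j * B j k)        ≈⟨ ⊗-coeff A′ B n k ⟨
    (A′ ⊗ B) n k                             ∎

  ⊗-assoc : ∀ A {B} D → LowerTriangular B → A ⊗ (B ⊗ D) ≈ₘ (A ⊗ B) ⊗ D
  ⊗-assoc A {B} D B-lower n k = begin
    (A ⊗ (B ⊗ D)) n k
      ≈⟨ ⊗-coeff A (B ⊗ D) n k ⟩
    ∑< (suc n) (λ j → A n j * (B ⊗ D) j k)
      ≈⟨ ∑<-cong (suc n) (λ j j<1+n → *-congˡ (trans (⊗-coeff B D j k) (∑<-extend _ j<1+n λ i j<i _ →
           trans (*-congʳ (B-lower j<i)) (zeroˡ (D i k))))) ⟩
    ∑< (suc n) (λ j → A n j * ∑< (suc n) (λ i → B j i * D i k))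
      ≈⟨ ∑<-cong (suc n) (λ j _ → trans (*-distribˡ-∑< (suc n) (A n j) _) (∑<-cong (suc n) λ i _ → sym (*-assoc _ _ _))) ⟩
    ∑< (suc n) (λ j → ∑< (suc n) (λ i → A n j * B j i * D i k))
      ≈⟨ ∑<-comm (suc n) (suc n) _ ⟩
    ∑< (suc n) (λ i → ∑< (suc n) (λ j → A n j * B j i * D i k))
      ≈⟨ ∑<-cong (suc n) (λ i _ → sym (trans (*-congʳ (⊗-coeff A B n i)) (*-distribʳ-∑< (suc n) (D i k) _))) ⟩
    ∑< (suc n) (λ i → (A ⊗ B) n i * D i k)
      ≈⟨ ⊗-coeff (A ⊗ B) D n k ⟨
    ((A ⊗ B) ⊗ D) n k ∎

  identityM-diag : ∀ n → identityM n n ≈ 1#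
  identityM-diag n = reflexive (≡.cong (λ b → if b then 1# else 0#) (dec-true (n ≟ n) ≡.refl))

  identityM-off : ∀ {n k} → n ≢ k → identityM n k ≈ 0#
  identityM-off {n} {k} n≢k = reflexive (≡.cong (λ b → if b then 1# else 0#) (dec-false (n ≟ k) n≢k))

  ⊗-identityˡ : ∀ D → identityM ⊗ D ≈ₘ D
  ⊗-identityˡ D n k = begin
    (identityM ⊗ D) n k                          ≈⟨ ⊗-coeff identityM D n k ⟩
    ∑< (suc n) (λ j → identityM n j * D j k)     ≈⟨ ∑<-single (suc n) n _ ℕₚ.≤-refl (λ j _ j≢n →
                                                      trans (*-congʳ (identityM-off (j≢n ∘ ≡.sym))) (zeroˡ _)) ⟩
    identityM n n * D n k                        ≈⟨ trans (*-congʳ (identityM-diag n)) (*-identityˡ _) ⟩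
    D n k                                        ∎

  ⊗-identityʳ : ∀ {D} → LowerTriangular D → D ⊗ identityM ≈ₘ D
  ⊗-identityʳ {D} D-lower n k with k ≤? n
  ... | yes k≤n = begin
    (D ⊗ identityM) n k                          ≈⟨ ⊗-coeff D identityM n k ⟩
    ∑< (suc n) (λ j → D n j * identityM j k)     ≈⟨ ∑<-single (suc n) k _ (s≤s k≤n) (λ j _ j≢k →
                                                      trans (*-congˡ (identityM-off j≢k)) (zeroʳ _)) ⟩
    D n k * identityM k k                        ≈⟨ trans (*-congˡ (identityM-diag k)) (*-identityʳ _) ⟩
    D n k                                        ∎
  ... | no k≰n = begin
    (D ⊗ identityM) n k                          ≈⟨ ⊗-coeff D identityM n k ⟩
    ∑< (suc n) (λ j → D n j * identityM j k)     ≈⟨ ∑<-zero (suc n) (λ j j<1+n → trans (*-congˡ (identityM-off λ j≡k →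
                                                      k≰n (≡.subst (_≤ n) j≡k (ℕₚ.≤-pred j<1+n)))) (zeroʳ _)) ⟩
    0#                                           ≈⟨ D-lower (ℕₚ.≰⇒> k≰n) ⟨
    D n k                                        ∎

  ⊗-cancelˡ : ∀ {V C C′} → (∀ n → ∃ λ y → y * V n n ≈ 1#) → V ⊗ C ≈ₘ V ⊗ C′ → C ≈ₘ C′
  ⊗-cancelˡ {V} {C} {C′} V-diag-invertible VC≈VC′ = <-rec (λ n → ∀ k → C n k ≈ C′ n k) row
    where
    open import Data.Nat.Induction using (<-rec)
    open import Algebra.Properties.Ring ring using (+-cancelˡ)
    cancel-diag : ∀ n {a b} → V n n * a ≈ V n n * b → a ≈ b
    cancel-diag n {a} {b} Va≈Vb with V-diag-invertible n
    ... | y , yV≈1 = begin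
      a                ≈⟨ trans (*-congʳ yV≈1) (*-identityˡ a) ⟨
      y * V n n * a    ≈⟨ trans (*-assoc _ _ _) (trans (*-congˡ Va≈Vb) (sym (*-assoc _ _ _))) ⟩
      y * V n n * b    ≈⟨ trans (*-congʳ yV≈1) (*-identityˡ b) ⟩
      b                ∎
    row : ∀ n → (∀ {j} → j < n → ∀ k → C j k ≈ C′ j k) → ∀ k → C n k ≈ C′ n k
    row n earlier-rows k = cancel-diag n (+-cancelˡ (∑< n (λ j → V n j * C′ j k)) _ _ (begin
      ∑< n (λ j → V n j * C′ j k) + V n n * C n k  ≈⟨ +-congʳ (∑<-cong n λ j j<n → *-congˡ (earlier-rows j<n k)) ⟨
      ∑< n (λ j → V n j * C j k) + V n n * C n k   ≈⟨ ⊗-coeff V C n k ⟨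
      (V ⊗ C) n k                                  ≈⟨ VC≈VC′ n k ⟩
      (V ⊗ C′) n k                                 ≈⟨ ⊗-coeff V C′ n k ⟩
      ∑< n (λ j → V n j * C′ j k) + V n n * C′ n k ∎))

  vhalf-lowerTriangular : ∀ t → LowerTriangular (vhalf t)
  vhalf-lowerTriangular t {n} {k} n<k =
    reflexive (≡.cong (λ b → if b then t (n ℕ.+ n ∸ k) n else 0#) (dec-false (k ≤? n) (ℕₚ.<⇒≱ n<k)))

  riordan-lowerTriangular : ∀ g q → LowerTriangular (riordan g (X ⋆ q))
  riordan-lowerTriangular g q {j} {k} j<k = begin
    (g ⋆ pow (X ⋆ q) k) j                ≈⟨ ⋆-cong ≐-refl (pow-⋆ X q k) j ⟩
    (g ⋆ (pow X k ⋆ pow q k)) j          ≈⟨ ⋆-leftComm g (pow X k) (pow q k) j ⟩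
    (pow X k ⋆ (g ⋆ pow q k)) j          ≈⟨ pow-X⋆-below k (g ⋆ pow q k) j j<k ⟩
    0#                                   ∎

  module _ {f h : Series} (f≐Xh : f ≐ X ⋆ h) where

    vhalf-entry : ∀ {n j} → j ≤ n → vhalf (riordan one f) n j ≈ pow h n (n ∸ j)
    vhalf-entry {n} {j} j≤n rewrite dec-true (j ≤? n) j≤n = begin
      (one ⋆ pow f n) (n ℕ.+ n ∸ j)        ≈⟨ ⋆-identityˡ (pow f n) _ ⟩
      pow f n (n ℕ.+ n ∸ j)                ≡⟨ ≡.cong (pow f n) (ℕₚ.+-∸-assoc n j≤n) ⟩
      pow f n (n ℕ.+ (n ∸ j))              ≈⟨ trans (pow-cong n f≐Xh _) (pow-⋆ X h n _) ⟩
      (pow X n ⋆ pow h n) (n ℕ.+ (n ∸ j))  ≈⟨ pow-X⋆-shift n (pow h n) (n ∸ j) ⟩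
      pow h n (n ∸ j)                      ∎

    vhalf-⊗ : ∀ M n k → (vhalf (riordan one f) ⊗ M) n k ≈ ((λ j → M j k) ⋆ pow h n) n
    vhalf-⊗ M n k = begin
      (vhalf (riordan one f) ⊗ M) n k                        ≈⟨ ⊗-coeff (vhalf (riordan one f)) M n k ⟩
      ∑< (suc n) (λ j → vhalf (riordan one f) n j * M j k)   ≈⟨ ∑<-cong (suc n) (λ j j<1+n →
                                                                 trans (*-congʳ (vhalf-entry (ℕₚ.≤-pred j<1+n))) (*-comm _ _)) ⟩
      ∑< (suc n) (λ j → M j k * pow h n (n ∸ j))             ≈⟨ ⋆-coeff (λ j → M j k) (pow h n) n ⟨
      ((λ j → M j k) ⋆ pow h n) n                            ∎

  [a+a]-[a+d]+d≈a : ∀ a d → (a + a) - (a + d) + d ≈ a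
  [a+a]-[a+d]+d≈a a d = begin
    (a + a) - (a + d) + d        ≈⟨ +-assoc (a + a) (- (a + d)) d ⟩
    (a + a) + (- (a + d) + d)    ≈⟨ +-congˡ -[a+d]+d≈-a ⟩
    (a + a) + - a                ≈⟨ +-assoc a a (- a) ⟩
    a + (a - a)                  ≈⟨ +-congˡ (-‿inverseʳ a) ⟩
    a + 0#                       ≈⟨ +-identityʳ a ⟩
    a                            ∎
    where
    open import Algebra.Properties.Ring ring using (-‿+-comm)
    -[a+d]+d≈-a : - (a + d) + d ≈ - a
    -[a+d]+d≈-a = begin
      - (a + d) + d      ≈⟨ +-congʳ (-‿+-comm a d) ⟨
      (- a + - d) + d    ≈⟨ +-assoc (- a) (- d) d ⟩
      - a + (- d + d)    ≈⟨ +-congˡ (-‿inverseˡ d) ⟩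
      - a + 0#           ≈⟨ +-identityʳ (- a) ⟩
      - a                ∎

  module RiordanInverse (f : Series) (u : Carrier) (f₀≈0 : f 0 ≈ 0#) (uf₁≈1 : u * f 1 ≈ 1#) where
    h g G : Series
    h = shiftDown f
    g = invSeries h u
    G = gInv f u

    V A : Matrix
    V = vhalf (riordan one f)
    A = riordan G (fInv f u)

    h⋆g≐one : h ⋆ g ≐ one
    h⋆g≐one = invSeries-inverse h u uf₁≈1

    f≐Xh : f ≐ X ⋆ h
    f≐Xh zero    = trans f₀≈0 (sym (X⋆-zero h))
    f≐Xh (suc n) = sym (X⋆-suc h n)

    deriv-f : deriv f ≐ h ⊕ X ⋆ deriv h
    deriv-f zero    = +-congˡ (sym (X⋆-zero (deriv h)))
    deriv-f (suc n) = +-congˡ (sym (X⋆-suc (deriv h) n))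

    -- D = x h'/h, so that G = 2 - x f'/f = 1 - D.
    D : Series
    D = X ⋆ (deriv h ⋆ g)

    G⊕D≐one : G ⊕ D ≐ one
    G⊕D≐one n = begin
      const (1# + 1#) n - (deriv f ⋆ g) n + D n   ≈⟨ +-congʳ (+-cong (two n) (-‿cong deriv-f⋆g)) ⟩
      (one n + one n) - (one n + D n) + D n       ≈⟨ [a+a]-[a+d]+d≈a (one n) (D n) ⟩
      one n                                       ∎
      where
      two : ∀ n → const (1# + 1#) n ≈ one n + one n
      two zero    = refl
      two (suc n) = sym (+-identityˡ 0#)
      deriv-f⋆g : (deriv f ⋆ g) n ≈ one n + D n
      deriv-f⋆g = trans (⋆-cong deriv-f (≐-refl {g}) n)
                  (trans (⋆-distribʳ g h (X ⋆ deriv h) n) (+-cong (h⋆g≐one n) (⋆-assoc X (deriv h) g n)))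

    G⋆P⊕D⋆P≐P : ∀ P → (G ⋆ P) ⊕ (D ⋆ P) ≐ P
    G⋆P⊕D⋆P≐P P n = begin
      ((G ⋆ P) ⊕ (D ⋆ P)) n   ≈⟨ ⋆-distribʳ P G D n ⟨
      ((G ⊕ D) ⋆ P) n         ≈⟨ ⋆-cong G⊕D≐one (≐-refl {P}) n ⟩
      (one ⋆ P) n             ≈⟨ ⋆-identityˡ P n ⟩
      P n                     ∎

    G⋆pow-diagonal : ∀ m → (G ⋆ pow h m) m ≈ identityM m 0
    G⋆pow-diagonal zero    = begin
      (G ⋆ one) 0                   ≈⟨ +-identityʳ _ ⟨
      (G ⋆ one) 0 + 0#              ≈⟨ +-congˡ (trans (⋆-assoc X (deriv h ⋆ g) one 0) (X⋆-zero ((deriv h ⋆ g) ⋆ one))) ⟨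
      (G ⋆ one) 0 + (D ⋆ one) 0     ≈⟨ G⋆P⊕D⋆P≐P one 0 ⟩
      1#                            ∎
    G⋆pow-diagonal (suc p) = +-identityˡ-unique _ _ (begin
      (G ⋆ P) (suc p) + P (suc p)          ≈⟨ +-congˡ D⋆P≈P ⟨
      (G ⋆ P) (suc p) + (D ⋆ P) (suc p)    ≈⟨ G⋆P⊕D⋆P≐P P (suc p) ⟩
      P (suc p)                            ∎)
      where
      open import Algebra.Properties.Ring ring using (+-identityˡ-unique)
      P : Series
      P = pow h (suc p)
      E⋆P≐h′⋆hᵖ : (deriv h ⋆ g) ⋆ P ≐ deriv h ⋆ pow h p
      E⋆P≐h′⋆hᵖ n = begin
        ((deriv h ⋆ g) ⋆ (h ⋆ pow h p)) n    ≈⟨ ⋆-cong (≐-refl {deriv h ⋆ g}) (⋆-comm h (pow h p)) n ⟩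
        ((deriv h ⋆ g) ⋆ (pow h p ⋆ h)) n    ≈⟨ ⋆-interchange (deriv h) g (pow h p) h n ⟩
        ((deriv h ⋆ pow h p) ⋆ (g ⋆ h)) n    ≈⟨ ⋆-cong (≐-refl {deriv h ⋆ pow h p}) (≐-trans (⋆-comm g h) h⋆g≐one) n ⟩
        ((deriv h ⋆ pow h p) ⋆ one) n        ≈⟨ trans (⋆-comm (deriv h ⋆ pow h p) one n) (⋆-identityˡ (deriv h ⋆ pow h p) n) ⟩
        (deriv h ⋆ pow h p) n                ∎
      D⋆P≈P : (D ⋆ P) (suc p) ≈ P (suc p)
      D⋆P≈P = begin
        (D ⋆ P) (suc p)                 ≈⟨ ⋆-assoc X (deriv h ⋆ g) P (suc p) ⟩
        (X ⋆ ((deriv h ⋆ g) ⋆ P)) (suc p) ≈⟨ X⋆-suc ((deriv h ⋆ g) ⋆ P) p ⟩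
        ((deriv h ⋆ g) ⋆ P) p           ≈⟨ E⋆P≐h′⋆hᵖ p ⟩
        (deriv h ⋆ pow h p) p           ≈⟨ pow-diagonal≈deriv⋆pow h p ⟨
        P (suc p)                       ∎

    column⋆pow : ∀ k n → (G ⋆ pow (fInv f u) k) ⋆ pow h n ≐ pow X k ⋆ (G ⋆ (pow g k ⋆ pow h n))
    column⋆pow k n i = begin
      ((G ⋆ pow (X ⋆ g) k) ⋆ pow h n) i                 ≈⟨ ⋆-cong (⋆-cong (≐-refl {G}) (pow-⋆ X g k)) (≐-refl {pow h n}) i ⟩
      ((G ⋆ (pow X k ⋆ pow g k)) ⋆ pow h n) i           ≈⟨ ⋆-assoc G (pow X k ⋆ pow g k) (pow h n) i ⟩
      (G ⋆ ((pow X k ⋆ pow g k) ⋆ pow h n)) i           ≈⟨ ⋆-cong (≐-refl {G}) (⋆-assoc (pow X k) (pow g k) (pow h n)) i ⟩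
      (G ⋆ (pow X k ⋆ (pow g k ⋆ pow h n))) i           ≈⟨ ⋆-leftComm G (pow X k) (pow g k ⋆ pow h n) i ⟩
      (pow X k ⋆ (G ⋆ (pow g k ⋆ pow h n))) i           ∎

    powᵍ⋆powʰ : ∀ k m → pow g k ⋆ pow h (k ℕ.+ m) ≐ pow h m
    powᵍ⋆powʰ k m i = begin
      (pow g k ⋆ pow h (k ℕ.+ m)) i             ≈⟨ ⋆-cong (≐-refl {pow g k}) (pow-+ h k m) i ⟩
      (pow g k ⋆ (pow h k ⋆ pow h m)) i         ≈⟨ ⋆-assoc (pow g k) (pow h k) (pow h m) i ⟨
      ((pow g k ⋆ pow h k) ⋆ pow h m) i         ≈⟨ ⋆-cong (≐-sym (pow-⋆ g h k)) (≐-refl {pow h m}) i ⟩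
      (pow (g ⋆ h) k ⋆ pow h m) i               ≈⟨ ⋆-cong (≐-trans (pow-cong k (≐-trans (⋆-comm g h) h⋆g≐one)) (pow-one k))
                                                          (≐-refl {pow h m}) i ⟩
      (one ⋆ pow h m) i                         ≈⟨ ⋆-identityˡ (pow h m) i ⟩
      pow h m i                                 ∎

    V⊗A≈I : V ⊗ A ≈ₘ identityM
    V⊗A≈I n k with k ≤? n
    ... | yes k≤n = ≡.subst (λ n → (V ⊗ A) n k ≈ identityM n k) (ℕₚ.m+[n∸m]≡n k≤n) (diagonal k (n ∸ k))
      where
      diagonal : ∀ k m → (V ⊗ A) (k ℕ.+ m) k ≈ identityM (k ℕ.+ m) k
      diagonal k m = begin
        (V ⊗ A) (k ℕ.+ m) k                                             ≈⟨ vhalf-⊗ f≐Xh A (k ℕ.+ m) k ⟩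
        ((G ⋆ pow (fInv f u) k) ⋆ pow h (k ℕ.+ m)) (k ℕ.+ m)             ≈⟨ column⋆pow k (k ℕ.+ m) (k ℕ.+ m) ⟩
        (pow X k ⋆ (G ⋆ (pow g k ⋆ pow h (k ℕ.+ m)))) (k ℕ.+ m)          ≈⟨ pow-X⋆-shift k (G ⋆ (pow g k ⋆ pow h (k ℕ.+ m))) m ⟩
        (G ⋆ (pow g k ⋆ pow h (k ℕ.+ m))) m                              ≈⟨ ⋆-cong (≐-refl {G}) (powᵍ⋆powʰ k m) m ⟩
        (G ⋆ pow h m) m                                                  ≈⟨ G⋆pow-diagonal m ⟩
        identityM m 0                                                    ≡⟨ ≡.cong (λ b → if b then 1# else 0#) k+m≡ᵇk ⟨
        identityM (k ℕ.+ m) k                                            ∎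
        where
        k+m≡ᵇk : (k ℕ.+ m ≡ᵇ k) ≡ (m ≡ᵇ 0)
        k+m≡ᵇk = ≡.trans (+-≡ᵇ-∸ m (ℕₚ.≤-refl {k})) (≡.cong (m ≡ᵇ_) (ℕₚ.n∸n≡0 k))
    ... | no k≰n = begin
      (V ⊗ A) n k                                     ≈⟨ vhalf-⊗ f≐Xh A n k ⟩
      ((G ⋆ pow (fInv f u) k) ⋆ pow h n) n             ≈⟨ column⋆pow k n n ⟩
      (pow X k ⋆ (G ⋆ (pow g k ⋆ pow h n))) n          ≈⟨ pow-X⋆-below k (G ⋆ (pow g k ⋆ pow h n)) n (ℕₚ.≰⇒> k≰n) ⟩
      0#                                              ≈⟨ identityM-off (λ n≡k → k≰n (ℕₚ.≤-reflexive (≡.sym n≡k))) ⟨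
      identityM n k                                   ∎

    A⊗V≈I : A ⊗ V ≈ₘ identityM
    A⊗V≈I = ⊗-cancelˡ V-diagonal-invertible λ n k → begin
      (V ⊗ (A ⊗ V)) n k     ≈⟨ ⊗-assoc V V (riordan-lowerTriangular G g) n k ⟩
      ((V ⊗ A) ⊗ V) n k     ≈⟨ ⊗-congˡ V V⊗A≈I n k ⟩
      (identityM ⊗ V) n k   ≈⟨ ⊗-identityˡ V n k ⟩
      V n k                 ≈⟨ ⊗-identityʳ (vhalf-lowerTriangular (riordan one f)) n k ⟨
      (V ⊗ identityM) n k   ∎
      where
      V-diagonal-invertible : ∀ n → ∃ λ y → y * V n n ≈ 1#
      V-diagonal-invertible n with pow-coeff₀-invertible uf₁≈1 n
      ... | y , y*hⁿ₀≈1 = y , trans (*-congˡ (trans (vhalf-entry f≐Xh (ℕₚ.≤-refl {n}))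
                                      (reflexive (≡.cong (pow h n) (ℕₚ.n∸n≡0 n))))) y*hⁿ₀≈1

mainTheorem6 : ∀ {c ℓ : Level} (R : CommutativeRing c ℓ) →
    let open CommutativeRing R
        open FPS R
    in (f : Series) (u : Carrier) →
       f 0 ≈ 0# →
       u * f 1 ≈ 1# →
       (∀ n k → (riordan (gInv f u) (fInv f u) ⊗ vhalf (riordan (const 1#) f)) n k ≈ identityM n k)
       × (∀ n k → (vhalf (riordan (const 1#) f) ⊗ riordan (gInv f u) (fInv f u)) n k ≈ identityM n k)
mainTheorem6 R f u f₀≈0 uf₁≈1 = A⊗V≈I , V⊗A≈I
  where open PowerSeries.RiordanInverse R f u f₀≈0 uf₁≈1
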